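{- Let $k$ be a positive integer and let $s_n=|\mathrm{Sch}^{\le k}_{2n}|$ for $n\ge0$. Then the sequence $(s_n)_{n\ge 0}$ satisfies a homogeneous linear recurrence, and its extension to negative indices satisfies $s_{ -n}=s_{n-1}$ for all $n\ge1$.
   Context: A Schröder path is a finite sequence of points of $\mathbb{Z}\times\mathbb{Z}_{\ge0}$ whose steps are each $(1,1)$, $(2,0)$ or $(1,-1)$; $\mathrm{Sch}^{\le k}_N$ is the set of Schröder paths from $(0,0)$ to $(N,0)$ staying weakly below the line $y=k$. If $(f_n)_{n\ge0}$ satisfies $f_n=c_1f_{n-1}+\cdots+c_df_{n-d}$ for all $n\ge d$ with $c_d\ne0$, it is extended uniquely to all $n\in\mathbb{Z}$ so that the recurrence holds for all $n\in\mathbb{Z}$. -}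

module Defs where

open import Data.Nat using (ℕ; zero; suc; _<ᵇ_)
open import Data.Bool using (Bool; true; false; if_then_else_)
open import Data.List using (List; []; _∷_; map; _++_; filter; length)
open import Data.Fin using (Fin; zero; suc)
open import Data.Integer using (ℤ; +_; _+_; _*_; _-_)
open import Relation.Nullary.Decidable using (does)
open import Relation.Binary.PropositionalEquality using (_≡_)
open import Data.Bool using (_≟_)

-- Steps of a Schröder path: U = (1,1), F = (2,0), D = (1,-1).
data Step : Set where
  U F D : Step

-- All step sequences whose total horizontal length is exactly N
-- (U and D have horizontal length 1, F has horizontal length 2).
words : ℕ → List (List Step)
words zero = [] ∷ []
words (suc zero) = map (U ∷_) (words zero) ++ map (D ∷_) (words zero)
words (suc (suc n)) =
  map (U ∷_) (words (suc n)) ++ map (D ∷_) (words (suc n)) ++ map (F ∷_) (words n)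

validFrom : ℕ → ℕ → List Step → Bool
validFrom k zero [] = true
validFrom k (suc h) [] = false
validFrom k h (U ∷ w) = if h <ᵇ k then validFrom k (suc h) w else false
validFrom k h (F ∷ w) = validFrom k h w
validFrom k zero (D ∷ w) = false
validFrom k (suc h) (D ∷ w) = validFrom k h w

-- The set Sch^{≤k}_N, as a list of step sequences (a Schröder path from (0,0)
-- is determined by its sequence of steps), and its cardinality.
Sch≤ : ℕ → ℕ → List (List Step)
Sch≤ k N = filter (λ w → validFrom k 0 w ≟ true) (words N)

s : ℕ → ℕ → ℕ
s k n = length (Sch≤ k (n Data.Nat.+ n))

-- rhs c f n = c₁ f(n-1) + c₂ f(n-2) + ... + c_d f(n-d),
-- where c i (i : Fin d) stands for the coefficient c_{i+1}.
rhs : ∀ {d} → (Fin d → ℤ) → (ℤ → ℤ) → ℤ → ℤ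
rhs {zero} c f n = + 0
rhs {suc d} c f n = c zero * f (n - + 1) + rhs (λ i → c (suc i)) (λ m → f (m - + 1)) n

-- Let a_h(N) count the step words of length N that lead from height h back to 0
-- inside the strip 0 ≤ y ≤ k.  Splitting off the first step gives
-- a_h(N+1) = a_{h+1}(N) + a_{h-1}(N) + a_h(N-1), with a_{-1} = a_{k+1} = 0.
-- Reversing time, a_h(-N-2) := (-1)^h a_h(N) and a_h(-1) := 0 extend this recurrence
-- to all N ∈ ℤ.  Read as a recurrence in h, it writes a_h as the operator
-- E^h U_h((E - E⁻¹)/2) applied to a_0, where E is the shift and U_h the Chebyshev
-- polynomial of the second kind.  Hence a_{k+1} = 0 is a linear recurrence for a_0
-- in steps of two, with leading and trailing coefficients ±1, valid on all of ℤ; on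
-- even arguments it is a recurrence for s_n = a_0(2n), and the reflection
-- a_0(-2m-2) = a_0(2m) is s_{-m-1} = s_m.
module Submission where

open import Defs
open import Data.Nat using (ℕ; zero; suc; _≤_; s≤s; _<ᵇ_; _⊔_)
import Data.Nat as Nat
import Data.Nat.Properties as ℕP
open import Data.Fin using (Fin; fromℕ; zero; suc; toℕ)
open import Data.Fin.Properties using (toℕ-fromℕ)
open import Data.Integer using (ℤ; +_; -[1+_]; _+_; _-_; _*_; -_; _^_; ∣_∣; 0ℤ; 1ℤ; -1ℤ)
import Data.Integer.Properties as ℤP
open import Data.Integer.Tactic.RingSolver using (solve-∀)
open import Data.Bool using (Bool; true; false; if_then_else_; _≟_)
open import Data.Bool.Properties using (T-≡; if-eta)
open import Data.List using (List; []; _∷_; map; _++_; length; filter)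
open import Data.List.Properties using (length-map; length-++; filter-++)
open import Data.Product using (Σ; _×_; _,_)
open import Function.Bundles using (Equivalence)
open import Relation.Binary.PropositionalEquality
  using (_≡_; _≢_; refl; sym; trans; cong; cong₂; subst; module ≡-Reasoning)
open ≡-Reasoning

coeff : List ℤ → ℕ → ℤ
coeff []      _       = 0ℤ
coeff (a ∷ _) zero    = a
coeff (_ ∷ p) (suc i) = coeff p i

infixl 6 _⊝_
_⊝_ : List ℤ → List ℤ → List ℤ
[]      ⊝ q       = map -_ q
(a ∷ p) ⊝ []      = a ∷ p
(a ∷ p) ⊝ (b ∷ q) = a - b ∷ p ⊝ q

coeff-beyond : ∀ p {i} → length p ≤ i → coeff p i ≡ 0ℤ
coeff-beyond []      _          = refl
coeff-beyond (a ∷ p) (s≤s p≤i)  = coeff-beyond p p≤i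

coeff-neg : ∀ q i → coeff (map -_ q) i ≡ - coeff q i
coeff-neg []      i       = refl
coeff-neg (b ∷ q) zero    = refl
coeff-neg (b ∷ q) (suc i) = coeff-neg q i

coeff-⊝ : ∀ p q i → coeff (p ⊝ q) i ≡ coeff p i - coeff q i
coeff-⊝ []      q       i       = trans (coeff-neg q i) (sym (ℤP.+-identityˡ _))
coeff-⊝ (a ∷ p) []      i       = sym (ℤP.+-identityʳ _)
coeff-⊝ (a ∷ p) (b ∷ q) zero    = refl
coeff-⊝ (a ∷ p) (b ∷ q) (suc i) = coeff-⊝ p q i

length-⊝ : ∀ p q → length (p ⊝ q) ≡ length p ⊔ length q
length-⊝ []      q       = length-map -_ q
length-⊝ (a ∷ p) []      = refl
length-⊝ (a ∷ p) (b ∷ q) = cong suc (length-⊝ p q)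

comb : List ℤ → ℤ → (ℤ → ℤ) → ℤ → ℤ
comb []      δ g M = 0ℤ
comb (a ∷ p) δ g M = a * g M + comb p δ g (M - δ)

comb-neg : ∀ q δ g M → comb (map -_ q) δ g M ≡ - comb q δ g M
comb-neg []      δ g M = refl
comb-neg (b ∷ q) δ g M = begin
  - b * g M + comb (map -_ q) δ g (M - δ)
    ≡⟨ cong₂ _+_ (sym (ℤP.neg-distribˡ-* b (g M))) (comb-neg q δ g (M - δ)) ⟩
  - (b * g M) + - comb q δ g (M - δ)
    ≡⟨ sym (ℤP.neg-distrib-+ (b * g M) _) ⟩
  - comb (b ∷ q) δ g M ∎

comb-⊝ : ∀ p q δ g M → comb (p ⊝ q) δ g M ≡ comb p δ g M - comb q δ g M
comb-⊝ []      q       δ g M = trans (comb-neg q δ g M) (sym (ℤP.+-identityˡ _))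
comb-⊝ (a ∷ p) []      δ g M = sym (ℤP.+-identityʳ _)
comb-⊝ (a ∷ p) (b ∷ q) δ g M =
  trans (cong (_+_ ((a - b) * g M)) (comb-⊝ p q δ g (M - δ))) (distrib a b (g M) _ _)
  where
  distrib : ∀ a b x u v → (a - b) * x + (u - v) ≡ (a * x + u) - (b * x + v)
  distrib = solve-∀

comb-0∷ : ∀ p δ g M → comb (0ℤ ∷ p) δ g M ≡ comb p δ g (M - δ)
comb-0∷ p δ g M = ℤP.+-identityˡ _

comb-translate : ∀ p δ e f M → comb p δ (λ m → f (m - e)) M ≡ comb p δ f (M - e)
comb-translate []      δ e f M = refl
comb-translate (a ∷ p) δ e f M = cong (_+_ (a * f (M - e))) (begin
  comb p δ (λ m → f (m - e)) (M - δ) ≡⟨ comb-translate p δ e f (M - δ) ⟩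
  comb p δ f (M - δ - e)             ≡⟨ cong (comb p δ f) (swap M δ e) ⟩
  comb p δ f (M - e - δ)             ∎)
  where
  swap : ∀ M δ e → M - δ - e ≡ M - e - δ
  swap = solve-∀

comb-double : ∀ p δ g M → comb p (δ + δ) g (M + M) ≡ comb p δ (λ m → g (m + m)) M
comb-double []      δ g M = refl
comb-double (a ∷ p) δ g M = cong (_+_ (a * g (M + M))) (begin
  comb p (δ + δ) g (M + M - (δ + δ))   ≡⟨ cong (comb p (δ + δ) g) (halve M δ) ⟩
  comb p (δ + δ) g (M - δ + (M - δ))   ≡⟨ comb-double p δ g (M - δ) ⟩
  comb p δ (λ m → g (m + m)) (M - δ)   ∎)
  where
  halve : ∀ M δ → M + M - (δ + δ) ≡ M - δ + (M - δ)
  halve = solve-∀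

rhs-neg : ∀ {d} (c : Fin d → ℤ) f n → rhs (λ i → - c i) f n ≡ - rhs c f n
rhs-neg {zero}  c f n = refl
rhs-neg {suc d} c f n = begin
  - c zero * f (n - 1ℤ) + rhs (λ i → - c (suc i)) (λ m → f (m - 1ℤ)) n
    ≡⟨ cong₂ _+_ (sym (ℤP.neg-distribˡ-* (c zero) (f (n - 1ℤ)))) (rhs-neg (λ i → c (suc i)) (λ m → f (m - 1ℤ)) n) ⟩
  - (c zero * f (n - 1ℤ)) + - rhs (λ i → c (suc i)) (λ m → f (m - 1ℤ)) n
    ≡⟨ sym (ℤP.neg-distrib-+ (c zero * f (n - 1ℤ)) _) ⟩
  - rhs c f n ∎

rhs-comb : ∀ {d} p f n → length p ≡ d →
           rhs {d} (λ i → coeff p (toℕ i)) f n ≡ comb p 1ℤ f (n - 1ℤ)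
rhs-comb {zero}  []      f n refl = refl
rhs-comb {suc d} (a ∷ p) f n len  = cong (_+_ (a * f (n - 1ℤ))) (begin
  rhs {d} (λ i → coeff p (toℕ i)) (λ m → f (m - 1ℤ)) n
    ≡⟨ rhs-comb p (λ m → f (m - 1ℤ)) n (ℕP.suc-injective len) ⟩
  comb p 1ℤ (λ m → f (m - 1ℤ)) (n - 1ℤ)
    ≡⟨ comb-translate p 1ℤ 1ℤ f (n - 1ℤ) ⟩
  comb p 1ℤ f (n - 1ℤ - 1ℤ) ∎)

annihilated⇒recurrence : ∀ {d} p (f : ℤ → ℤ) → length p ≡ suc d → coeff p 0 ≡ 1ℤ →
                         (∀ n → comb p 1ℤ f n ≡ 0ℤ) →
                         ∀ n → f n ≡ rhs {d} (λ i → - coeff p (suc (toℕ i))) f n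
annihilated⇒recurrence {d} (a ∷ t) f len refl annihilated n = begin
  f n                                    ≡⟨ isolate (f n) _ ⟩
  1ℤ * f n + comb t 1ℤ f (n - 1ℤ) - comb t 1ℤ f (n - 1ℤ)
                                         ≡⟨ cong (_- comb t 1ℤ f (n - 1ℤ)) (annihilated n) ⟩
  0ℤ - comb t 1ℤ f (n - 1ℤ)              ≡⟨ ℤP.+-identityˡ _ ⟩
  - comb t 1ℤ f (n - 1ℤ)                 ≡⟨ cong -_ (sym (rhs-comb t f n (ℕP.suc-injective len))) ⟩
  - rhs {d} (λ i → coeff t (toℕ i)) f n  ≡⟨ sym (rhs-neg {d} (λ i → coeff t (toℕ i)) f n) ⟩
  rhs {d} (λ i → - coeff t (toℕ i)) f n  ∎
  where
  isolate : ∀ x y → x ≡ 1ℤ * x + y - y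
  isolate = solve-∀

-- chebyshev j encodes E^(j-1) U_(j-1)((E - E⁻¹)/2) as a polynomial in E⁻², leading
-- coefficient first, where E is the shift and U_j are the Chebyshev polynomials of the
-- second kind.

chebyshev : ℕ → List ℤ
chebyshev 0             = []
chebyshev 1             = 1ℤ ∷ []
chebyshev (suc (suc j)) = chebyshev (suc j) ⊝ (0ℤ ∷ chebyshev (suc j)) ⊝ (0ℤ ∷ chebyshev j)

length-chebyshev : ∀ j → length (chebyshev j) ≡ j
length-chebyshev 0             = refl
length-chebyshev 1             = refl
length-chebyshev (suc (suc j)) = begin
  length (chebyshev (suc j) ⊝ (0ℤ ∷ chebyshev (suc j)) ⊝ (0ℤ ∷ chebyshev j))
    ≡⟨ length-⊝ (chebyshev (suc j) ⊝ (0ℤ ∷ chebyshev (suc j))) (0ℤ ∷ chebyshev j) ⟩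
  length (chebyshev (suc j) ⊝ (0ℤ ∷ chebyshev (suc j))) ⊔ suc (length (chebyshev j))
    ≡⟨ cong (_⊔ suc (length (chebyshev j))) (length-⊝ (chebyshev (suc j)) (0ℤ ∷ chebyshev (suc j))) ⟩
  (length (chebyshev (suc j)) ⊔ suc (length (chebyshev (suc j)))) ⊔ suc (length (chebyshev j))
    ≡⟨ cong₂ (λ m n → (m ⊔ suc m) ⊔ suc n) (length-chebyshev (suc j)) (length-chebyshev j) ⟩
  (suc j ⊔ suc (suc j)) ⊔ suc j
    ≡⟨ cong (_⊔ suc j) (ℕP.m≤n⇒m⊔n≡n (ℕP.n≤1+n (suc j))) ⟩
  suc (suc j) ⊔ suc j
    ≡⟨ ℕP.m≥n⇒m⊔n≡m (ℕP.n≤1+n (suc j)) ⟩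
  suc (suc j) ∎

head-chebyshev : ∀ j → coeff (chebyshev (suc j)) 0 ≡ 1ℤ
head-chebyshev zero    = refl
head-chebyshev (suc j) = begin
  coeff (chebyshev (suc j) ⊝ (0ℤ ∷ chebyshev (suc j)) ⊝ (0ℤ ∷ chebyshev j)) 0
    ≡⟨ coeff-⊝ (chebyshev (suc j) ⊝ (0ℤ ∷ chebyshev (suc j))) (0ℤ ∷ chebyshev j) 0 ⟩
  coeff (chebyshev (suc j) ⊝ (0ℤ ∷ chebyshev (suc j))) 0 - 0ℤ
    ≡⟨ cong (_- 0ℤ) (coeff-⊝ (chebyshev (suc j)) (0ℤ ∷ chebyshev (suc j)) 0) ⟩
  coeff (chebyshev (suc j)) 0 - 0ℤ - 0ℤ
    ≡⟨ cong (λ x → x - 0ℤ - 0ℤ) (head-chebyshev j) ⟩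
  1ℤ ∎

∣last-chebyshev∣ : ∀ j → ∣ coeff (chebyshev (suc j)) j ∣ ≡ 1
∣last-chebyshev∣ zero    = refl
∣last-chebyshev∣ (suc j) = begin
  ∣ coeff (c ⊝ (0ℤ ∷ c) ⊝ (0ℤ ∷ c′)) (suc j) ∣
    ≡⟨ cong ∣_∣ (coeff-⊝ (c ⊝ (0ℤ ∷ c)) (0ℤ ∷ c′) (suc j)) ⟩
  ∣ coeff (c ⊝ (0ℤ ∷ c)) (suc j) - coeff c′ j ∣
    ≡⟨ cong₂ (λ x y → ∣ x - y ∣) (coeff-⊝ c (0ℤ ∷ c) (suc j)) (coeff-beyond c′ (short j)) ⟩
  ∣ coeff c (suc j) - coeff c j - 0ℤ ∣
    ≡⟨ cong (λ x → ∣ x - coeff c j - 0ℤ ∣) (coeff-beyond c (short (suc j))) ⟩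
  ∣ 0ℤ - coeff c j - 0ℤ ∣
    ≡⟨ cong ∣_∣ (trans (ℤP.+-identityʳ (0ℤ - coeff c j)) (ℤP.+-identityˡ (- coeff c j))) ⟩
  ∣ - coeff c j ∣
    ≡⟨ ℤP.∣-i∣≡∣i∣ (coeff c j) ⟩
  ∣ coeff c j ∣
    ≡⟨ ∣last-chebyshev∣ j ⟩
  1 ∎
  where
  c c′ : List ℤ
  c  = chebyshev (suc j)
  c′ = chebyshev j
  short : ∀ i → length (chebyshev i) ≤ i
  short i = ℕP.≤-reflexive (length-chebyshev i)

count : {A : Set} → (A → Bool) → List A → ℕ
count p xs = length (filter (λ x → p x ≟ true) xs)

count-++ : ∀ {A : Set} (p : A → Bool) xs ys → count p (xs ++ ys) ≡ count p xs Nat.+ count p ys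
count-++ p xs ys =
  trans (cong length (filter-++ (λ x → p x ≟ true) xs ys)) (length-++ (filter _ xs))

count-map : ∀ {A B : Set} (p : B → Bool) (f : A → B) xs →
            count p (map f xs) ≡ count (λ x → p (f x)) xs
count-map p f []       = refl
count-map p f (x ∷ xs) with p (f x)
... | true  = cong suc (count-map p f xs)
... | false = count-map p f xs

count-cong : ∀ {A : Set} {p q : A → Bool} → (∀ x → p x ≡ q x) → ∀ xs → count p xs ≡ count q xs
count-cong         p≗q []       = refl
count-cong {q = q} p≗q (x ∷ xs) rewrite p≗q x with q x
... | true  = cong suc (count-cong p≗q xs)
... | false = count-cong p≗q xs

count-false : ∀ {A : Set} (xs : List A) → count (λ _ → false) xs ≡ 0
count-false []       = refl
count-false (x ∷ xs) = count-false xs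

count-if : ∀ {A : Set} (p : A → Bool) b xs →
           count (λ x → if b then p x else false) xs ≡ (if b then count p xs else 0)
count-if p true  xs = refl
count-if p false xs = count-false xs

-- Three-term recurrences and their continuation to negative times

prev : (ℕ → ℕ) → ℕ → ℕ
prev u zero    = 0
prev u (suc n) = u n

extend : ℤ → (ℕ → ℕ) → ℤ → ℤ
extend σ u (+ n)    = + u n
extend σ u -[1+ n ] = σ * + prev u n

extend-zero : ∀ {σ u} → (∀ n → u n ≡ 0) → ∀ N → extend σ u N ≡ 0ℤ
extend-zero     u≡0 (+ n)          = cong +_ (u≡0 n)
extend-zero {σ} u≡0 -[1+ zero ]    = ℤP.*-zeroʳ σ
extend-zero {σ} u≡0 -[1+ suc n ]   = trans (cong (λ x → σ * + x) (u≡0 n)) (ℤP.*-zeroʳ σ)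

extend-pred : ∀ σ u n → extend σ u (+ n - 1ℤ) ≡ + prev u n
extend-pred σ u zero    = ℤP.*-zeroʳ σ
extend-pred σ u (suc n) = refl

extend-recurrence : ∀ {σ τ υ} {a b c : ℕ → ℕ} → τ ≡ - σ → υ ≡ - σ → σ * + a 0 ≡ + a 0 →
                    (∀ n → a (suc n) ≡ b n Nat.+ c n Nat.+ prev a n) →
                    ∀ N → extend σ a (N + 1ℤ) ≡ extend τ b N + extend υ c N + extend σ a (N - 1ℤ)
extend-recurrence {σ} {a = a} {b} {c} refl refl _ rec (+ n) = begin
  + a (n Nat.+ 1)                 ≡⟨ cong (λ m → + a m) (ℕP.+-comm n 1) ⟩
  + a (suc n)                     ≡⟨ cong +_ (rec n) ⟩
  + b n + + c n + + prev a n      ≡⟨ cong (_+_ (+ b n + + c n)) (sym (extend-pred σ a n)) ⟩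
  + b n + + c n + extend σ a (+ n - 1ℤ) ∎
extend-recurrence {σ} {a = a} refl refl σa₀≡a₀ _ -[1+ zero ] = sym (begin
  - σ * 0ℤ + - σ * 0ℤ + σ * + a 0 ≡⟨ cong₂ (λ x y → x + y + σ * + a 0) (ℤP.*-zeroʳ (- σ)) (ℤP.*-zeroʳ (- σ)) ⟩
  0ℤ + σ * + a 0                  ≡⟨ ℤP.+-identityˡ _ ⟩
  σ * + a 0                       ≡⟨ σa₀≡a₀ ⟩
  + a 0                           ∎)
extend-recurrence {σ} {a = a} {b} {c} refl refl _ rec -[1+ suc m ] = sym (begin
  - σ * + b m + - σ * + c m + σ * + a (suc (m Nat.+ 0))
    ≡⟨ cong (λ n → - σ * + b m + - σ * + c m + σ * + a (suc n)) (ℕP.+-identityʳ m) ⟩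
  - σ * + b m + - σ * + c m + σ * + a (suc m)
    ≡⟨ cong (λ x → - σ * + b m + - σ * + c m + σ * + x) (rec m) ⟩
  - σ * + b m + - σ * + c m + σ * (+ b m + + c m + + prev a m)
    ≡⟨ cancel σ (+ b m) (+ c m) (+ prev a m) ⟩
  σ * + prev a m ∎)
  where
  cancel : ∀ σ x y z → - σ * x + - σ * y + σ * (x + y + z) ≡ σ * z
  cancel = solve-∀

-1^suc : ∀ h → -1ℤ ^ suc h ≡ - (-1ℤ ^ h)
-1^suc h = ℤP.-1*i≡-i (-1ℤ ^ h)

-- Paths in the strip 0 ≤ y ≤ k

<ᵇ-irrefl : ∀ n → (n <ᵇ n) ≡ false
<ᵇ-irrefl zero    = refl
<ᵇ-irrefl (suc n) = <ᵇ-irrefl n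

module _ (k : ℕ) where

  paths : ℕ → ℕ → ℕ
  paths h N = count (validFrom k h) (words N)

  validFrom-U : ∀ h w → validFrom k h (U ∷ w) ≡ (if h <ᵇ k then validFrom k (suc h) w else false)
  validFrom-U zero    w = refl
  validFrom-U (suc h) w = refl

  validFrom-F : ∀ h w → validFrom k h (F ∷ w) ≡ validFrom k h w
  validFrom-F zero    w = refl
  validFrom-F (suc h) w = refl

  count-U : ∀ h ws → count (validFrom k h) (map (U ∷_) ws)
                   ≡ (if h <ᵇ k then count (validFrom k (suc h)) ws else 0)
  count-U h ws = begin
    count (validFrom k h) (map (U ∷_) ws)                                   ≡⟨ count-map _ _ ws ⟩
    count (λ w → validFrom k h (U ∷ w)) ws                                  ≡⟨ count-cong (validFrom-U h) ws ⟩
    count (λ w → if h <ᵇ k then validFrom k (suc h) w else false) ws        ≡⟨ count-if _ (h <ᵇ k) ws ⟩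
    (if h <ᵇ k then count (validFrom k (suc h)) ws else 0)                  ∎

  count-D : ∀ h ws → count (validFrom k h) (map (D ∷_) ws) ≡ prev (λ i → count (validFrom k i) ws) h
  count-D zero    ws = trans (count-map _ _ ws) (count-false ws)
  count-D (suc h) ws = count-map _ _ ws

  count-F : ∀ h ws → count (validFrom k h) (map (F ∷_) ws) ≡ count (validFrom k h) ws
  count-F h ws = trans (count-map _ _ ws) (count-cong (validFrom-F h) ws)

  paths-suc : ∀ h N → paths h (suc N)
            ≡ (if h <ᵇ k then paths (suc h) N else 0) Nat.+ prev (λ i → paths i N) h Nat.+ prev (paths h) N
  paths-suc h zero = begin
    count (validFrom k h) (map (U ∷_) (words 0) ++ map (D ∷_) (words 0))
      ≡⟨ count-++ (validFrom k h) (map (U ∷_) (words 0)) _ ⟩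
    count (validFrom k h) (map (U ∷_) (words 0)) Nat.+ count (validFrom k h) (map (D ∷_) (words 0))
      ≡⟨ cong₂ Nat._+_ (count-U h (words 0)) (count-D h (words 0)) ⟩
    (if h <ᵇ k then paths (suc h) 0 else 0) Nat.+ prev (λ i → paths i 0) h
      ≡⟨ sym (ℕP.+-identityʳ _) ⟩
    (if h <ᵇ k then paths (suc h) 0 else 0) Nat.+ prev (λ i → paths i 0) h Nat.+ 0 ∎
  paths-suc h (suc N) = begin
    count (validFrom k h) (map (U ∷_) (words (suc N)) ++ map (D ∷_) (words (suc N)) ++ map (F ∷_) (words N))
      ≡⟨ count-++ (validFrom k h) (map (U ∷_) (words (suc N))) _ ⟩
    count (validFrom k h) (map (U ∷_) (words (suc N)))
      Nat.+ count (validFrom k h) (map (D ∷_) (words (suc N)) ++ map (F ∷_) (words N))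
      ≡⟨ cong (count (validFrom k h) (map (U ∷_) (words (suc N))) Nat.+_)
              (count-++ (validFrom k h) (map (D ∷_) (words (suc N))) _) ⟩
    count (validFrom k h) (map (U ∷_) (words (suc N)))
      Nat.+ (count (validFrom k h) (map (D ∷_) (words (suc N))) Nat.+ count (validFrom k h) (map (F ∷_) (words N)))
      ≡⟨ cong₂ Nat._+_ (count-U h (words (suc N))) (cong₂ Nat._+_ (count-D h (words (suc N))) (count-F h (words N))) ⟩
    (if h <ᵇ k then paths (suc h) (suc N) else 0) Nat.+ (prev (λ i → paths i (suc N)) h Nat.+ paths h N)
      ≡⟨ sym (ℕP.+-assoc (if h <ᵇ k then paths (suc h) (suc N) else 0) _ _) ⟩
    (if h <ᵇ k then paths (suc h) (suc N) else 0) Nat.+ prev (λ i → paths i (suc N)) h Nat.+ paths h N ∎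

  -- Starting heights above k are cut to 0, so that the recurrence also holds at height k.
  bounded : ℕ → ℕ → ℕ
  bounded h N = if h <ᵇ suc k then paths h N else 0

  bounded-≤ : ∀ {h N} → h ≤ k → bounded h N ≡ paths h N
  bounded-≤ {h} {N} h≤k =
    cong (λ b → if b then paths h N else 0) (Equivalence.to T-≡ (ℕP.<⇒<ᵇ (s≤s h≤k)))

  bounded-above : ∀ N → bounded (suc k) N ≡ 0
  bounded-above N = cong (λ b → if b then paths (suc k) N else 0) (<ᵇ-irrefl k)

  bounded-empty : ∀ h → bounded (suc h) 0 ≡ 0
  bounded-empty h = if-eta (h <ᵇ k)

  bounded-suc : ∀ {h} → h ≤ k → ∀ n →
                bounded h (suc n) ≡ bounded (suc h) n Nat.+ prev (λ i → bounded i n) h Nat.+ prev (bounded h) n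
  bounded-suc {h} h≤k n = begin
    bounded h (suc n)
      ≡⟨ bounded-≤ {N = suc n} h≤k ⟩
    paths h (suc n)
      ≡⟨ paths-suc h n ⟩
    bounded (suc h) n Nat.+ prev (λ i → paths i n) h Nat.+ prev (paths h) n
      ≡⟨ cong₂ (λ x y → bounded (suc h) n Nat.+ x Nat.+ y) (below h h≤k) (earlier n) ⟩
    bounded (suc h) n Nat.+ prev (λ i → bounded i n) h Nat.+ prev (bounded h) n ∎
    where
    below : ∀ i → i ≤ k → prev (λ i → paths i n) i ≡ prev (λ i → bounded i n) i
    below zero    _   = refl
    below (suc i) i<k = sym (bounded-≤ {N = n} (ℕP.<⇒≤ i<k))
    earlier : ∀ m → prev (paths h) m ≡ prev (bounded h) m
    earlier zero    = refl
    earlier (suc m) = sym (bounded-≤ {N = m} h≤k)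

  signedPaths : ℕ → ℤ → ℤ
  signedPaths h = extend (-1ℤ ^ h) (bounded h)

  signedPaths↓ : ℕ → ℤ → ℤ
  signedPaths↓ zero    _ = 0ℤ
  signedPaths↓ (suc h)   = signedPaths h

  signedPaths-above : ∀ N → signedPaths (suc k) N ≡ 0ℤ
  signedPaths-above = extend-zero bounded-above

  signedPaths-recurrence : ∀ {h} → h ≤ k → ∀ N →
    signedPaths h (N + 1ℤ) ≡ signedPaths (suc h) N + signedPaths↓ h N + signedPaths h (N - 1ℤ)
  signedPaths-recurrence {zero} h≤k N = begin
    signedPaths 0 (N + 1ℤ)
      ≡⟨ extend-recurrence refl refl (ℤP.*-identityˡ _) (bounded-suc h≤k) N ⟩
    signedPaths 1 N + extend -1ℤ (λ _ → 0) N + signedPaths 0 (N - 1ℤ)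
      ≡⟨ cong (λ x → signedPaths 1 N + x + signedPaths 0 (N - 1ℤ)) (extend-zero (λ _ → refl) N) ⟩
    signedPaths 1 N + 0ℤ + signedPaths 0 (N - 1ℤ) ∎
  signedPaths-recurrence {suc h} h≤k =
    extend-recurrence (-1^suc (suc h)) (trans (sym (ℤP.neg-involutive _)) (cong -_ (sym (-1^suc h))))
      (subst (λ x → -1ℤ ^ suc h * + x ≡ + x) (sym (bounded-empty h)) (ℤP.*-zeroʳ (-1ℤ ^ suc h)))
      (bounded-suc h≤k)

  signedPaths↓-chebyshev : ∀ j → j ≤ suc (suc k) → ∀ N →
    signedPaths↓ j N ≡ comb (chebyshev j) (+ 2) (signedPaths 0) (N + + j - 1ℤ)
  signedPaths↓-chebyshev zero _ N = refl
  signedPaths↓-chebyshev (suc zero) _ N = trans (cong (signedPaths 0) (shift N)) (pad _)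
    where
    shift : ∀ N → N ≡ N + 1ℤ - 1ℤ
    shift = solve-∀
    pad : ∀ x → x ≡ 1ℤ * x + 0ℤ
    pad = solve-∀
  signedPaths↓-chebyshev (suc (suc j)) j+2≤ N = begin
    signedPaths (suc j) N
      ≡⟨ isolate-above (signedPaths-recurrence (ℕP.≤-pred (ℕP.≤-pred j+2≤)) N) ⟩
    signedPaths j (N + 1ℤ) - signedPaths j (N - 1ℤ) - signedPaths↓ j N
      ≡⟨ cong₂ _-_ (cong₂ _-_ (signedPaths↓-chebyshev (suc j) j+1≤ (N + 1ℤ))
                           (signedPaths↓-chebyshev (suc j) j+1≤ (N - 1ℤ)))
                (signedPaths↓-chebyshev j (ℕP.<⇒≤ j+1≤) N) ⟩
    comb c₁ (+ 2) g (N + 1ℤ + J₁ - 1ℤ) - comb c₁ (+ 2) g (N - 1ℤ + J₁ - 1ℤ) - comb c₀ (+ 2) g (N + J - 1ℤ)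
      ≡⟨ cong₂ _-_ (cong₂ _-_ (cong (comb c₁ (+ 2) g) (offset-up N J))
                               (trans (cong (comb c₁ (+ 2) g) (offset-down N J)) (sym (comb-0∷ c₁ _ g M))))
                   (trans (cong (comb c₀ (+ 2) g) (offset-below N J)) (sym (comb-0∷ c₀ _ g M))) ⟩
    comb c₁ (+ 2) g M - comb (0ℤ ∷ c₁) (+ 2) g M - comb (0ℤ ∷ c₀) (+ 2) g M
      ≡⟨ cong (_- comb (0ℤ ∷ c₀) (+ 2) g M) (sym (comb-⊝ c₁ (0ℤ ∷ c₁) _ g M)) ⟩
    comb (c₁ ⊝ (0ℤ ∷ c₁)) (+ 2) g M - comb (0ℤ ∷ c₀) (+ 2) g M
      ≡⟨ sym (comb-⊝ (c₁ ⊝ (0ℤ ∷ c₁)) (0ℤ ∷ c₀) _ g M) ⟩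
    comb (chebyshev (suc (suc j))) (+ 2) g M ∎
    where
    g : ℤ → ℤ
    g = signedPaths 0
    c₀ c₁ : List ℤ
    c₀ = chebyshev j
    c₁ = chebyshev (suc j)
    J J₁ M : ℤ
    J  = + j
    J₁ = 1ℤ + J
    M  = N + (1ℤ + J₁) - 1ℤ
    j+1≤ : suc j ≤ suc (suc k)
    j+1≤ = ℕP.<⇒≤ j+2≤
    isolate-above : ∀ {x y z w} → x ≡ y + z + w → y ≡ x - w - z
    isolate-above {x} {y} {z} {w} x≡ = trans (rearrange y z w) (cong (λ v → v - w - z) (sym x≡))
      where
      rearrange : ∀ y z w → y ≡ y + z + w - w - z
      rearrange = solve-∀
    offset-up : ∀ N J → N + 1ℤ + (1ℤ + J) - 1ℤ ≡ N + (1ℤ + (1ℤ + J)) - 1ℤ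
    offset-up = solve-∀
    offset-down : ∀ N J → N - 1ℤ + (1ℤ + J) - 1ℤ ≡ N + (1ℤ + (1ℤ + J)) - 1ℤ - + 2
    offset-down = solve-∀
    offset-below : ∀ N J → N + J - 1ℤ ≡ N + (1ℤ + (1ℤ + J)) - 1ℤ - + 2
    offset-below = solve-∀

  chebyshev-annihilates : ∀ M → comb (chebyshev (suc (suc k))) (+ 2) (signedPaths 0) M ≡ 0ℤ
  chebyshev-annihilates M = begin
    comb (chebyshev (suc (suc k))) (+ 2) (signedPaths 0) M
      ≡⟨ cong (comb (chebyshev (suc (suc k))) (+ 2) (signedPaths 0)) (recentre M K) ⟩
    comb (chebyshev (suc (suc k))) (+ 2) (signedPaths 0) (M - K + 1ℤ + K - 1ℤ)
      ≡⟨ sym (signedPaths↓-chebyshev (suc (suc k)) ℕP.≤-refl (M - K + 1ℤ)) ⟩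
    signedPaths (suc k) (M - K + 1ℤ)
      ≡⟨ signedPaths-above (M - K + 1ℤ) ⟩
    0ℤ ∎
    where
    K : ℤ
    K = + suc (suc k)
    recentre : ∀ M K → M ≡ M - K + 1ℤ + K - 1ℤ
    recentre = solve-∀

corollary9p7 : (k : ℕ) → 1 ≤ k →
    Σ ℕ λ d → Σ (Fin (suc d) → ℤ) λ c → Σ (ℤ → ℤ) λ f →
      (c (fromℕ d) ≢ + 0)
      × ((n : ℕ) → f (+ n) ≡ + (s k n))
      × ((n : ℤ) → f n ≡ rhs c f n)
      × ((m : ℕ) → f (-[1+ m ]) ≡ f (+ m))
corollary9p7 k _ = k , c , f , last≢0 , (λ n → refl) , recurrence , (λ m → ℤP.*-identityˡ _)
  where
  p : List ℤ
  p = chebyshev (suc (suc k))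
  c : Fin (suc k) → ℤ
  c i = - coeff p (suc (toℕ i))
  f : ℤ → ℤ
  f n = signedPaths k 0 (n + n)
  recurrence : ∀ n → f n ≡ rhs c f n
  recurrence = annihilated⇒recurrence p f (length-chebyshev (suc (suc k))) (head-chebyshev (suc k))
    (λ n → trans (sym (comb-double p 1ℤ (signedPaths k 0) n)) (chebyshev-annihilates k (n + n)))
  last≢0 : c (fromℕ k) ≢ + 0
  last≢0 c≡0 = ℕP.0≢1+n (begin
    0                                      ≡⟨ cong ∣_∣ (sym c≡0) ⟩
    ∣ - coeff p (suc (toℕ (fromℕ k))) ∣    ≡⟨ ℤP.∣-i∣≡∣i∣ (coeff p (suc (toℕ (fromℕ k)))) ⟩
    ∣ coeff p (suc (toℕ (fromℕ k))) ∣      ≡⟨ cong (λ i → ∣ coeff p (suc i) ∣) (toℕ-fromℕ k) ⟩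
    ∣ coeff p (suc k) ∣                    ≡⟨ ∣last-chebyshev∣ (suc k) ⟩
    1                                      ∎)
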